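{- A connected graph $G$ is star-uniform if and only if the number of edges in a maximum matching of $G$ equals the domination number $\gamma(G)$.
   Context: All graphs are finite and simple. A star is a graph isomorphic to $K_{1,n}$ for some $n\ge 1$. A star-factor of a graph $G$ is a spanning subgraph of $G$ each of whose components is a star. A graph $G$ is star-uniform if all star-factors of $G$ have the same number of components. $\gamma(G)$ is the minimum size of a set $S\subseteq V(G)$ such that every vertex of $G$ is in $S$ or adjacent to a vertex of $S$. -}

module Defs where

open import Data.Nat using (ℕ; _≤_)
open import Data.Bool using (Bool; true; false)
open import Data.Fin using (Fin)
open import Data.Fin.Subset using (Subset; _∈_; ∣_∣)
open import Data.List using (List; []; _∷_; length; concatMap)
open import Data.List.Relation.Unary.All using (All)
open import Data.List.Relation.Unary.Unique.Propositional using (Unique)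
open import Data.Product using (Σ; ∃; ∃-syntax; _×_; _,_)
open import Data.Sum using (_⊎_)
open import Relation.Nullary using (¬_)
open import Relation.Binary.PropositionalEquality using (_≡_; _≢_)
open import Function.Bundles using (_⇔_)
open import Function.Definitions using (Surjective)

record Graph (n : ℕ) : Set where
  field
    adj   : Fin n → Fin n → Bool
    sym   : ∀ u v → adj u v ≡ true → adj v u ≡ true
    irrefl : ∀ v → adj v v ≡ false
open Graph public

data Reach {n : ℕ} (E : Fin n → Fin n → Bool) : Fin n → Fin n → Set where
  here : ∀ {u} → Reach E u u
  step : ∀ {u w v} → E u w ≡ true → Reach E w v → Reach E u v

Connected : ∀ {n} → Graph n → Set
Connected G = ∀ u v → Reach (adj G) u v

IsSpanningSubgraph : ∀ {n} → Graph n → (Fin n → Fin n → Bool) → Set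
IsSpanningSubgraph G H =
  (∀ u v → H u v ≡ true → adj G u v ≡ true) × (∀ u v → H u v ≡ true → H v u ≡ true)

ComponentIsStar : ∀ {n} → (Fin n → Fin n → Bool) → Fin n → Set
ComponentIsStar H v =
  Σ _ λ c → Reach H v c
    × (∃[ y ] (Reach H c y × y ≢ c))
    × (∀ x y → Reach H c x → Reach H c y →
         (H x y ≡ true ⇔ ((x ≡ c × y ≢ c) ⊎ (y ≡ c × x ≢ c))))

IsStarFactor : ∀ {n} → Graph n → (Fin n → Fin n → Bool) → Set
IsStarFactor G H = IsSpanningSubgraph G H × (∀ v → ComponentIsStar H v)

-- H has exactly k components: a surjective labelling of vertices by Fin k
-- identifying exactly the vertices in the same component.
HasComponents : ∀ {n} → (Fin n → Fin n → Bool) → ℕ → Set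
HasComponents {n} H k =
  Σ (Fin n → Fin k) λ f → Surjective _≡_ _≡_ f × (∀ u v → (f u ≡ f v ⇔ Reach H u v))

StarUniform : ∀ {n} → Graph n → Set
StarUniform G = ∀ H₁ H₂ k₁ k₂ → IsStarFactor G H₁ → IsStarFactor G H₂ →
  HasComponents H₁ k₁ → HasComponents H₂ k₂ → k₁ ≡ k₂

endpoints : ∀ {n} → List (Fin n × Fin n) → List (Fin n)
endpoints = concatMap (λ { (u , v) → u ∷ v ∷ [] })

IsMatching : ∀ {n} → Graph n → List (Fin n × Fin n) → Set
IsMatching G M = All (λ { (u , v) → adj G u v ≡ true }) M × Unique (endpoints M)

IsMatchingNumber : ∀ {n} → Graph n → ℕ → Set
IsMatchingNumber G k =
  (∃[ M ] (IsMatching G M × length M ≡ k)) × (∀ M → IsMatching G M → length M ≤ k)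

IsDominating : ∀ {n} → Graph n → Subset n → Set
IsDominating G S = ∀ v → v ∈ S ⊎ (∃[ u ] (u ∈ S × adj G u v ≡ true))

IsDominationNumber : ∀ {n} → Graph n → ℕ → Set
IsDominationNumber G k =
  (∃[ S ] (IsDominating G S × ∣ S ∣ ≡ k)) × (∀ S → IsDominating G S → k ≤ ∣ S ∣)

module Submission where

-- Every star-factor F of G with k components satisfies γ ≤ k ≤ ν: the k centres
-- dominate G, and the k centre-leaf edges form a matching (StarFactorBounds).
-- Conversely two particular star-factors are built, both from centre maps, i.e.
-- idempotent choices of a centre for each vertex (CentreMap, StarFactorOf):
-- from a maximum matching M one with at least ∣ M ∣ = ν components, using that M
-- admits no free edge and no augmenting path of length three
-- (FromMaximumMatching); and from a minimum dominating set S one with at most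
-- ∣ S ∣ = γ components, using that no vertex of S can be dropped
-- (FromMinimumDominatingSet).  If G is star-uniform the two factors have the
-- same number k of components, so ν ≤ k ≤ γ ≤ ν; if ν = γ every star-factor has
-- exactly ν components.

open import Defs renaming (sym to adj-sym)
open import Data.Nat using (ℕ; zero; suc; _≤_; z≤n; s≤s)
open import Data.Nat.Properties using (≤-trans; ≤-antisym; n≮n)
open import Data.Bool using (Bool; true; false; if_then_else_)
import Data.Bool.Properties as Bool
open import Data.Fin using (Fin; zero; suc; _≟_)
open import Data.Fin.Properties using (injective⇒≤; any?)
open import Data.Fin.Subset using (Subset; _∈_; _∉_; ∣_∣; _-_; ⊤)
open import Data.Fin.Subset.Properties using (_∈?_; ∈⊤; ∣⊤∣≡n; x∈p∧x≢y⇒x∈p-y; x∈p⇒∣p-x∣<∣p∣)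
open import Data.Vec using (_∷_; here; there; tabulate)
open import Data.Vec.Properties using ([]=⇒lookup; lookup⇒[]=; lookup∘tabulate)
open import Data.List using (List; []; _∷_; length; map; allFin)
open import Data.List.Properties using (length-map; length-tabulate)
open import Data.List.Relation.Unary.All as All using (All; []; _∷_)
open import Data.List.Relation.Unary.All.Properties using (¬Any⇒All¬; All¬⇒¬Any; map⁺)
open import Data.List.Relation.Unary.Any using (here; there)
open import Data.List.Membership.Propositional using () renaming (_∈_ to _∈ₗ_)
open import Data.List.Relation.Unary.Unique.Propositional using (Unique; []; _∷_)
open import Data.List.Relation.Unary.Unique.Propositional.Properties using (allFin⁺)
open import Data.Product using (Σ; ∃; ∃-syntax; _×_; _,_; proj₁; proj₂)
open import Data.Sum using (_⊎_; inj₁; inj₂; swap) renaming (map to ⊎-map)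
open import Data.Empty using (⊥; ⊥-elim)
open import Relation.Nullary using (¬_; Dec; yes; no; does; ¬?)
open import Relation.Nullary.Decidable using (_×-dec_; _⊎-dec_)
open import Relation.Binary.PropositionalEquality using (_≡_; _≢_; refl; sym; trans; cong; subst)
open import Function.Bundles using (_⇔_; mk⇔; Equivalence)

does⇔ : ∀ {A : Set} (a? : Dec A) → does a? ≡ true ⇔ A
does⇔ (yes a) = mk⇔ (λ _ → a) (λ _ → refl)
does⇔ (no ¬a) = mk⇔ (λ ()) (λ a → ⊥-elim (¬a a))

select : ∀ {n} {P : Fin n → Set} → (∀ v → Dec (P v)) → Subset n
select P? = tabulate (λ v → does (P? v))

∈select⇔ : ∀ {n} {P : Fin n → Set} (P? : ∀ v → Dec (P v)) v → v ∈ select P? ⇔ P v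
∈select⇔ P? v = mk⇔
  (λ v∈ → Equivalence.to (does⇔ (P? v)) (trans (sym (lookup∘tabulate _ v)) ([]=⇒lookup v∈)))
  (λ Pv → lookup⇒[]= v _ (trans (lookup∘tabulate _ v) (Equivalence.from (does⇔ (P? v)) Pv)))

rank : ∀ {n} (S : Subset n) (v : Fin n) → v ∈ S → Fin ∣ S ∣
rank (true ∷ S) zero here = zero
rank (true ∷ S) (suc v) (there p) = suc (rank S v p)
rank (false ∷ S) (suc v) (there p) = rank S v p

unrank : ∀ {n} (S : Subset n) → Fin ∣ S ∣ → Fin n
unrank (true ∷ S) zero = zero
unrank (true ∷ S) (suc j) = suc (unrank S j)
unrank (false ∷ S) j = suc (unrank S j)

unrank∈ : ∀ {n} (S : Subset n) (j : Fin ∣ S ∣) → unrank S j ∈ S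
unrank∈ (true ∷ S) zero = here
unrank∈ (true ∷ S) (suc j) = there (unrank∈ S j)
unrank∈ (false ∷ S) j = there (unrank∈ S j)

unrank-rank : ∀ {n} (S : Subset n) v p → unrank S (rank S v p) ≡ v
unrank-rank (true ∷ S) zero here = refl
unrank-rank (true ∷ S) (suc v) (there p) = cong suc (unrank-rank S v p)
unrank-rank (false ∷ S) (suc v) (there p) = cong suc (unrank-rank S v p)

rank-unrank : ∀ {n} (S : Subset n) j p → rank S (unrank S j) p ≡ j
rank-unrank (true ∷ S) zero here = refl
rank-unrank (true ∷ S) (suc j) (there p) = cong suc (rank-unrank S j p)
rank-unrank (false ∷ S) j (there p) = rank-unrank S j p

rank-cong : ∀ {n} (S : Subset n) {u v} p q → u ≡ v → rank S u p ≡ rank S v q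
rank-cong (true ∷ S) here here refl = refl
rank-cong (true ∷ S) (there p) (there q) refl = cong suc (rank-cong S p q refl)
rank-cong (false ∷ S) (there p) (there q) refl = rank-cong S p q refl

rank-injective : ∀ {n} (S : Subset n) {u v} p q → rank S u p ≡ rank S v q → u ≡ v
rank-injective S {u} {v} p q e =
  trans (sym (unrank-rank S u p)) (trans (cong (unrank S) e) (unrank-rank S v q))

unrank-injective : ∀ {n} (S : Subset n) {i j} → unrank S i ≡ unrank S j → i ≡ j
unrank-injective S {i} {j} e = trans (sym (rank-unrank S i (unrank∈ S i)))
  (trans (rank-cong S (unrank∈ S i) (unrank∈ S j) e) (rank-unrank S j (unrank∈ S j)))

injection⇒∣∣≤ : ∀ {n m} (S : Subset n) (T : Subset m) (h : ∀ x → x ∈ S → Fin m) →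
  (∀ x p → h x p ∈ T) → (∀ x y p q → h x p ≡ h y q → x ≡ y) → ∣ S ∣ ≤ ∣ T ∣
injection⇒∣∣≤ S T h h∈T h-inj = injective⇒≤ {f = g} g-injective
  where
  g : Fin ∣ S ∣ → Fin ∣ T ∣
  g j = rank T (h (unrank S j) (unrank∈ S j)) (h∈T _ _)
  g-injective : ∀ {i j} → g i ≡ g j → i ≡ j
  g-injective e = unrank-injective S (h-inj _ _ _ _ (rank-injective T _ _ e))

unique⇒length≤∣∣ : ∀ {n} (C : Subset n) (xs : List (Fin n)) →
  Unique xs → All (_∈ C) xs → length xs ≤ ∣ C ∣
unique⇒length≤∣∣ C [] _ _ = z≤n
unique⇒length≤∣∣ C (x ∷ xs) (x∉xs ∷ xs-unique) (x∈C ∷ xs⊆C) =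
  ≤-trans (s≤s (unique⇒length≤∣∣ (C - x) xs xs-unique xs⊆C-x)) (x∈p⇒∣p-x∣<∣p∣ x∈C)
  where
  xs⊆C-x : All (_∈ C - x) xs
  xs⊆C-x = All.zipWith (λ (x≢y , y∈C) → x∈p∧x≢y⇒x∈p-y y∈C (λ e → x≢y (sym e))) (x∉xs , xs⊆C)

reach-trans : ∀ {n} {E : Fin n → Fin n → Bool} {u v w} → Reach E u v → Reach E v w → Reach E u w
reach-trans here q = q
reach-trans (step e p) q = step e (reach-trans p q)

reach-sym : ∀ {n} {E : Fin n → Fin n → Bool} → (∀ u v → E u v ≡ true → E v u ≡ true) →
  ∀ {u v} → Reach E u v → Reach E v u
reach-sym E-sym here = here
reach-sym E-sym (step e p) = reach-trans (reach-sym E-sym p) (step (E-sym _ _ e) here)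

adj⇒≢ : ∀ {n} (G : Graph n) {x y} → adj G x y ≡ true → x ≢ y
adj⇒≢ G {x} e refl with trans (sym e) (irrefl G x)
... | ()

adj-resp : ∀ {n} (G : Graph n) {x x′ y y′} → x ≡ x′ → y ≡ y′ → adj G x y ≡ true → adj G x′ y′ ≡ true
adj-resp G refl refl xy = xy

connected⇒neighbour : ∀ {n} → 2 ≤ n → (G : Graph n) → Connected G → ∀ x → ∃[ w ] (adj G x w ≡ true)
connected⇒neighbour {suc (suc m)} (s≤s (s≤s z≤n)) G connected x =
  first-step (connected x (other x)) (other≢ x)
  where
  other : Fin (suc (suc m)) → Fin (suc (suc m))
  other zero = suc zero
  other (suc _) = zero
  other≢ : ∀ x → x ≢ other x
  other≢ zero ()
  other≢ (suc _) ()
  first-step : ∀ {t} → Reach (adj G) x t → x ≢ t → ∃[ w ] (adj G x w ≡ true)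
  first-step here x≢x = ⊥-elim (x≢x refl)
  first-step (step {w = w} e _) _ = w , e

-- The
-- fibres of a centre map are the stars of a star-factor of G.
record CentreMap {n} (G : Graph n) : Set where
  field
    centre      : Fin n → Fin n
    centre-idem : ∀ v → centre (centre v) ≡ centre v
    centre-adj  : ∀ v → centre v ≢ v → adj G v (centre v) ≡ true
    has-leaf    : ∀ v → ∃[ u ] (centre u ≡ centre v × u ≢ centre v)

module StarFactorOf {n} {G : Graph n} (T : CentreMap G) where
  open CentreMap T

  StarEdge : Fin n → Fin n → Set
  StarEdge x y = x ≢ y × (centre x ≡ y ⊎ centre y ≡ x)

  starEdge? : ∀ x y → Dec (StarEdge x y)
  starEdge? x y = ¬? (x ≟ y) ×-dec (centre x ≟ y ⊎-dec centre y ≟ x)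

  starGraph : Fin n → Fin n → Bool
  starGraph x y = does (starEdge? x y)

  edge⁻ : ∀ x y → starGraph x y ≡ true → StarEdge x y
  edge⁻ x y = Equivalence.to (does⇔ (starEdge? x y))

  edge⁺ : ∀ x y → StarEdge x y → starGraph x y ≡ true
  edge⁺ x y = Equivalence.from (does⇔ (starEdge? x y))

  starGraph-sym : ∀ x y → starGraph x y ≡ true → starGraph y x ≡ true
  starGraph-sym x y e with edge⁻ x y e
  ... | x≢y , c = edge⁺ y x ((λ q → x≢y (sym q)) , swap c)

  -- The two ends of an edge have the same centre, so components lie inside fibres.
  starGraph-centre : ∀ x y → starGraph x y ≡ true → centre x ≡ centre y
  starGraph-centre x y e with proj₂ (edge⁻ x y e)
  ... | inj₁ cx≡y = trans (sym (centre-idem x)) (cong centre cx≡y)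
  ... | inj₂ cy≡x = trans (cong centre (sym cy≡x)) (centre-idem y)

  reach⇒same-centre : ∀ {u v} → Reach starGraph u v → centre u ≡ centre v
  reach⇒same-centre here = refl
  reach⇒same-centre (step e p) = trans (starGraph-centre _ _ e) (reach⇒same-centre p)

  reach-centre : ∀ v → Reach starGraph v (centre v)
  reach-centre v with centre v ≟ v
  ... | yes c≡v = subst (Reach starGraph v) (sym c≡v) here
  ... | no c≢v = step (edge⁺ v (centre v) ((λ q → c≢v (sym q)) , inj₁ refl)) here

  same-centre⇒reach : ∀ {u v} → centre u ≡ centre v → Reach starGraph u v
  same-centre⇒reach {u} {v} e =
    reach-trans (reach-centre u)
      (subst (λ c → Reach starGraph c v) (sym e) (reach-sym starGraph-sym (reach-centre v)))

  starGraph-spanning : IsSpanningSubgraph G starGraph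
  starGraph-spanning = starGraph⊆G , starGraph-sym
    where
    starGraph⊆G : ∀ u v → starGraph u v ≡ true → adj G u v ≡ true
    starGraph⊆G u v e with edge⁻ u v e
    ... | u≢v , inj₁ cu≡v =
      subst (λ w → adj G u w ≡ true) cu≡v (centre-adj u (λ q → u≢v (trans (sym q) cu≡v)))
    ... | u≢v , inj₂ cv≡u = adj-sym G v u
      (subst (λ w → adj G v w ≡ true) cv≡u (centre-adj v (λ q → u≢v (trans (sym cv≡u) q))))

  component-is-star : ∀ v → ComponentIsStar starGraph v
  component-is-star v = c , reach-centre v , (leaf , leaf-reach , leaf≢c) , star-shape
    where
    c : Fin n
    c = centre v
    leaf : Fin n
    leaf = proj₁ (has-leaf v)
    leaf-reach : Reach starGraph c leaf
    leaf-reach = same-centre⇒reach (trans (centre-idem v) (sym (proj₁ (proj₂ (has-leaf v)))))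
    leaf≢c : leaf ≢ c
    leaf≢c = proj₂ (proj₂ (has-leaf v))
    star-shape : ∀ x y → Reach starGraph c x → Reach starGraph c y →
      (starGraph x y ≡ true ⇔ ((x ≡ c × y ≢ c) ⊎ (y ≡ c × x ≢ c)))
    star-shape x y rx ry = mk⇔ to from
      where
      cx : centre x ≡ c
      cx = trans (sym (reach⇒same-centre rx)) (centre-idem v)
      cy : centre y ≡ c
      cy = trans (sym (reach⇒same-centre ry)) (centre-idem v)
      to : starGraph x y ≡ true → (x ≡ c × y ≢ c) ⊎ (y ≡ c × x ≢ c)
      to e with edge⁻ x y e
      ... | x≢y , inj₁ cx≡y = inj₂ (y≡c , λ x≡c → x≢y (trans x≡c (sym y≡c)))
        where
        y≡c : y ≡ c
        y≡c = trans (sym cx≡y) cx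
      ... | x≢y , inj₂ cy≡x = inj₁ (x≡c , λ y≡c → x≢y (trans x≡c (sym y≡c)))
        where
        x≡c : x ≡ c
        x≡c = trans (sym cy≡x) cy
      from : (x ≡ c × y ≢ c) ⊎ (y ≡ c × x ≢ c) → starGraph x y ≡ true
      from (inj₁ (x≡c , y≢c)) = edge⁺ x y ((λ x≡y → y≢c (trans (sym x≡y) x≡c)) , inj₂ (trans cy (sym x≡c)))
      from (inj₂ (y≡c , x≢c)) = edge⁺ x y ((λ x≡y → x≢c (trans x≡y y≡c)) , inj₁ (trans cx (sym y≡c)))

  starGraph-factor : IsStarFactor G starGraph
  starGraph-factor = starGraph-spanning , component-is-star

  is-centre? : ∀ v → Dec (centre v ≡ v)
  is-centre? v = centre v ≟ v

  centres : Subset n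
  centres = select is-centre?

  fixed⇒∈centres : ∀ v → centre v ≡ v → v ∈ centres
  fixed⇒∈centres v = Equivalence.from (∈select⇔ is-centre? v)

  ∈centres⇒fixed : ∀ v → v ∈ centres → centre v ≡ v
  ∈centres⇒fixed v = Equivalence.to (∈select⇔ is-centre? v)

  centre∈centres : ∀ v → centre v ∈ centres
  centre∈centres v = fixed⇒∈centres (centre v) (centre-idem v)

  starGraph-components : HasComponents starGraph ∣ centres ∣
  starGraph-components = label , label-surjective , label⇔reach
    where
    label : Fin n → Fin ∣ centres ∣
    label v = rank centres (centre v) (centre∈centres v)
    label-surjective : ∀ j → ∃ λ x → ∀ {z} → z ≡ x → label z ≡ j
    label-surjective j = unrank centres j , λ { refl →
      trans (rank-cong centres _ (unrank∈ centres j) (∈centres⇒fixed _ (unrank∈ centres j)))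
            (rank-unrank centres j _) }
    label⇔reach : ∀ u v → (label u ≡ label v ⇔ Reach starGraph u v)
    label⇔reach u v = mk⇔ (λ e → same-centre⇒reach (rank-injective centres _ _ e))
                          (λ r → rank-cong centres _ _ (reach⇒same-centre r))

module _ {n k : ℕ} (label : Fin n → Fin k) (a b : Fin k → Fin n)
         (label-a : ∀ i → label (a i) ≡ i) (label-b : ∀ i → label (b i) ≡ i)
         (a≢b : ∀ i → a i ≢ b i) where

  private
    pair : Fin k → Fin n × Fin n
    pair i = a i , b i

    endpoints-All : (P : Fin n → Set) → ∀ is → All (λ j → P (a j) × P (b j)) is →
      All P (endpoints (map pair is))
    endpoints-All P [] _ = []
    endpoints-All P (j ∷ is) ((p , q) ∷ r) = p ∷ q ∷ endpoints-All P is r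

    apart : ∀ i is → All (i ≢_) is → ∀ x → label x ≡ i → All (λ j → x ≢ a j × x ≢ b j) is
    apart i [] _ x _ = []
    apart i (j ∷ is) (i≢j ∷ ds) x lx =
      ((λ e → i≢j (trans (sym lx) (trans (cong label e) (label-a j))))
      , (λ e → i≢j (trans (sym lx) (trans (cong label e) (label-b j))))) ∷ apart i is ds x lx

  labelled-pairs-unique : ∀ is → Unique is → Unique (endpoints (map pair is))
  labelled-pairs-unique [] _ = []
  labelled-pairs-unique (i ∷ is) (i∉is ∷ is-unique) =
    (a≢b i ∷ endpoints-All _ is (apart i is i∉is (a i) (label-a i)))
    ∷ endpoints-All _ is (apart i is i∉is (b i) (label-b i))
    ∷ labelled-pairs-unique is is-unique

module StarFactorBounds {n} (G : Graph n) (F : Fin n → Fin n → Bool) (F-factor : IsStarFactor G F)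
                        (k : ℕ) (F-components : HasComponents F k) where

  private
    label : Fin n → Fin k
    label = proj₁ F-components
    label⇔reach : ∀ u v → (label u ≡ label v ⇔ Reach F u v)
    label⇔reach = proj₂ (proj₂ F-components)

    rep : Fin k → Fin n
    rep i = proj₁ (proj₁ (proj₂ F-components) i)
    label-rep : ∀ i → label (rep i) ≡ i
    label-rep i = proj₂ (proj₁ (proj₂ F-components) i) refl
    star : ∀ i → ComponentIsStar F (rep i)
    star i = proj₂ F-factor (rep i)

    centre : Fin k → Fin n
    centre i = proj₁ (star i)
    leaf : Fin k → Fin n
    leaf i = proj₁ (proj₁ (proj₂ (proj₂ (star i))))

    rep-reach-centre : ∀ i → Reach F (rep i) (centre i)
    rep-reach-centre i = proj₁ (proj₂ (star i))
    centre-reach-leaf : ∀ i → Reach F (centre i) (leaf i)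
    centre-reach-leaf i = proj₁ (proj₂ (proj₁ (proj₂ (proj₂ (star i)))))
    leaf≢centre : ∀ i → leaf i ≢ centre i
    leaf≢centre i = proj₂ (proj₂ (proj₁ (proj₂ (proj₂ (star i)))))
    star-edge : ∀ i x y → Reach F (centre i) x → Reach F (centre i) y →
      (F x y ≡ true ⇔ ((x ≡ centre i × y ≢ centre i) ⊎ (y ≡ centre i × x ≢ centre i)))
    star-edge i = proj₂ (proj₂ (proj₂ (star i)))

    label-centre : ∀ i → label (centre i) ≡ i
    label-centre i = trans (sym (Equivalence.from (label⇔reach _ _) (rep-reach-centre i))) (label-rep i)
    label-leaf : ∀ i → label (leaf i) ≡ i
    label-leaf i = trans (sym (Equivalence.from (label⇔reach _ _) (centre-reach-leaf i))) (label-centre i)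

    centre-adj : ∀ i v → Reach F (centre i) v → v ≢ centre i → adj G (centre i) v ≡ true
    centre-adj i v cv v≢c = proj₁ (proj₁ F-factor) _ _
      (Equivalence.from (star-edge i (centre i) v here cv) (inj₁ (refl , v≢c)))

  centre-leaf-matching : List (Fin n × Fin n)
  centre-leaf-matching = map (λ i → centre i , leaf i) (allFin k)

  centre-leaf-isMatching : IsMatching G centre-leaf-matching
  centre-leaf-isMatching =
    map⁺ (All.tabulate (λ {i} _ → centre-adj i (leaf i) (centre-reach-leaf i) (leaf≢centre i))) ,
    labelled-pairs-unique label centre leaf label-centre label-leaf (λ i e → leaf≢centre i (sym e))
                          (allFin k) (allFin⁺ k)

  components≤ν : ∀ ν → IsMatchingNumber G ν → k ≤ ν
  components≤ν ν ν-max = subst (_≤ ν) length-matching (proj₂ ν-max _ centre-leaf-isMatching)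
    where
    length-matching : length centre-leaf-matching ≡ k
    length-matching = trans (length-map _ (allFin k)) (length-tabulate (λ i → i))

  is-centre? : ∀ v → Dec (∃[ i ] (centre i ≡ v))
  is-centre? v = any? (λ i → centre i ≟ v)

  centreSet : Subset n
  centreSet = select is-centre?

  centreSet-dominating : IsDominating G centreSet
  centreSet-dominating v with v ≟ centre (label v)
  ... | yes v≡c = inj₁ (Equivalence.from (∈select⇔ is-centre? v) (label v , sym v≡c))
  ... | no v≢c =
    inj₂ (centre i , Equivalence.from (∈select⇔ is-centre? (centre i)) (i , refl) , centre-adj i v centre-reach-v v≢c)
    where
    i : Fin k
    i = label v
    centre-reach-v : Reach F (centre i) v
    centre-reach-v = reach-sym (proj₂ (proj₁ F-factor))
      (reach-trans (Equivalence.to (label⇔reach v (rep i)) (sym (label-rep i))) (rep-reach-centre i))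

  γ≤components : ∀ γ → IsDominationNumber G γ → γ ≤ k
  γ≤components γ γ-min = ≤-trans (proj₂ γ-min centreSet centreSet-dominating)
    (subst (∣ centreSet ∣ ≤_) (∣⊤∣≡n k) (injection⇒∣∣≤ centreSet ⊤ index (λ _ _ → ∈⊤) index-injective))
    where
    index : ∀ x → x ∈ centreSet → Fin k
    index x p = proj₁ (Equivalence.to (∈select⇔ is-centre? x) p)
    index-injective : ∀ x y p q → index x p ≡ index y q → x ≡ y
    index-injective x y p q e = trans (sym (proj₂ (Equivalence.to (∈select⇔ is-centre? x) p)))
      (trans (cong centre e) (proj₂ (Equivalence.to (∈select⇔ is-centre? y) q)))

  components≡ν : ∀ ν γ → IsMatchingNumber G ν → IsDominationNumber G γ → ν ≡ γ → k ≡ ν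
  components≡ν ν γ ν-max γ-min ν≡γ =
    ≤-antisym (components≤ν ν ν-max) (subst (_≤ k) (sym ν≡γ) (γ≤components γ γ-min))

Edges : ℕ → Set
Edges n = List (Fin n × Fin n)

module _ {n : ℕ} where

  ends∈endpoints : ∀ (M : Edges n) {a b} → (a , b) ∈ₗ M → a ∈ₗ endpoints M × b ∈ₗ endpoints M
  ends∈endpoints ((u , v) ∷ M) (here refl) = here refl , there (here refl)
  ends∈endpoints ((u , v) ∷ M) (there p) =
    there (there (proj₁ (ends∈endpoints M p))) , there (there (proj₂ (ends∈endpoints M p)))

  ends-distinct : ∀ (M : Edges n) {a b} → Unique (endpoints M) → (a , b) ∈ₗ M → a ≢ b
  ends-distinct ((u , v) ∷ M) ((u≢v ∷ _) ∷ _) (here refl) = u≢v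
  ends-distinct ((u , v) ∷ M) (_ ∷ _ ∷ M-unique) (there p) = ends-distinct M M-unique p

  -- edgeAt M v is the first edge of M containing v (a dummy loop if there is none).
  edgeAt : Edges n → Fin n → Fin n × Fin n
  edgeAt [] v = v , v
  edgeAt ((a , b) ∷ M) v with v ≟ a | v ≟ b
  ... | yes _ | _ = a , b
  ... | no _ | yes _ = a , b
  ... | no _ | no _ = edgeAt M v

  edgeAt-skip : ∀ a b M v → v ≢ a → v ≢ b → edgeAt ((a , b) ∷ M) v ≡ edgeAt M v
  edgeAt-skip a b M v v≢a v≢b with v ≟ a | v ≟ b
  ... | yes v≡a | _ = ⊥-elim (v≢a v≡a)
  ... | no _ | yes v≡b = ⊥-elim (v≢b v≡b)
  ... | no _ | no _ = refl

  edgeAt-hit : ∀ a b M v → (v ≡ a ⊎ v ≡ b) → edgeAt ((a , b) ∷ M) v ≡ (a , b)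
  edgeAt-hit a b M v v∈ab with v ≟ a | v ≟ b
  ... | yes _ | _ = refl
  ... | no _ | yes _ = refl
  edgeAt-hit a b M v (inj₁ v≡a) | no v≢a | no _ = ⊥-elim (v≢a v≡a)
  edgeAt-hit a b M v (inj₂ v≡b) | no _ | no v≢b = ⊥-elim (v≢b v≡b)

  edgeAt-ends : ∀ (M : Edges n) {a b} → Unique (endpoints M) → (a , b) ∈ₗ M →
    edgeAt M a ≡ (a , b) × edgeAt M b ≡ (a , b)
  edgeAt-ends ((u , v) ∷ M) _ (here refl) = edgeAt-hit u v M u (inj₁ refl) , edgeAt-hit u v M v (inj₂ refl)
  edgeAt-ends ((u , v) ∷ M) {a} {b} ((_ ∷ u∉M) ∷ v∉M ∷ M-unique) (there p) =
    trans (edgeAt-skip u v M a (not-u (proj₁ ends)) (not-v (proj₁ ends))) (proj₁ (edgeAt-ends M M-unique p)) ,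
    trans (edgeAt-skip u v M b (not-u (proj₂ ends)) (not-v (proj₂ ends))) (proj₂ (edgeAt-ends M M-unique p))
    where
    ends : a ∈ₗ endpoints M × b ∈ₗ endpoints M
    ends = ends∈endpoints M p
    not-u : ∀ {x} → x ∈ₗ endpoints M → x ≢ u
    not-u x∈M x≡u = All¬⇒¬Any u∉M (subst (_∈ₗ endpoints M) x≡u x∈M)
    not-v : ∀ {x} → x ∈ₗ endpoints M → x ≢ v
    not-v x∈M x≡v = All¬⇒¬Any v∉M (subst (_∈ₗ endpoints M) x≡v x∈M)

  edgeAt-∈ : ∀ (M : Edges n) {v} → v ∈ₗ endpoints M →
    edgeAt M v ∈ₗ M × (v ≡ proj₁ (edgeAt M v) ⊎ v ≡ proj₂ (edgeAt M v))
  edgeAt-∈ ((a , b) ∷ M) {v} p with v ≟ a | v ≟ b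
  ... | yes v≡a | _ = here refl , inj₁ v≡a
  ... | no _ | yes v≡b = here refl , inj₂ v≡b
  edgeAt-∈ ((a , b) ∷ M) (here v≡a) | no v≢a | no _ = ⊥-elim (v≢a v≡a)
  edgeAt-∈ ((a , b) ∷ M) (there (here v≡b)) | no _ | no v≢b = ⊥-elim (v≢b v≡b)
  edgeAt-∈ ((a , b) ∷ M) (there (there p)) | no _ | no _ = there (proj₁ (edgeAt-∈ M p)) , proj₂ (edgeAt-∈ M p)

module Augment {n : ℕ} (G : Graph n) where

  IsEdge : Fin n × Fin n → Set
  IsEdge e = adj G (proj₁ e) (proj₂ e) ≡ true

  augment-free-edge : ∀ (M : Edges n) {x y} → IsMatching G M →
    All (x ≢_) (endpoints M) → All (y ≢_) (endpoints M) → adj G x y ≡ true → IsMatching G ((x , y) ∷ M)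
  augment-free-edge M (M-edges , M-unique) x∉M y∉M xy =
    (xy ∷ M-edges) , ((adj⇒≢ G xy ∷ x∉M) ∷ y∉M ∷ M-unique)

  -- Replacing a b ∈ M by x a and b y gives a larger matching M′; the last component,
  -- needed for the recursion, says that M′ covers nothing new besides x and y.
  augment-path : ∀ (M : Edges n) {a b x y} → Unique (endpoints M) → All IsEdge M → (a , b) ∈ₗ M →
    All (x ≢_) (endpoints M) → All (y ≢_) (endpoints M) → x ≢ y → adj G x a ≡ true → adj G b y ≡ true →
    Σ (Edges n) λ M′ → Unique (endpoints M′) × All IsEdge M′ × length M′ ≡ suc (length M)
      × (∀ z → All (z ≢_) (endpoints M) → z ≢ x → z ≢ y → All (z ≢_) (endpoints M′))
  augment-path ((a , b) ∷ R) {x = x} {y} ((a≢b ∷ a∉R) ∷ b∉R ∷ R-unique) (_ ∷ R-edges) (here refl)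
               (x≢a ∷ x≢b ∷ x∉R) (y≢a ∷ y≢b ∷ y∉R) x≢y xa by =
    ((x , a) ∷ (b , y) ∷ R) ,
    ((x≢a ∷ x≢b ∷ x≢y ∷ x∉R) ∷ (a≢b ∷ (λ e → y≢a (sym e)) ∷ a∉R) ∷ ((λ e → y≢b (sym e)) ∷ b∉R)
      ∷ y∉R ∷ R-unique) ,
    xa ∷ by ∷ R-edges , refl ,
    λ { z (z≢a ∷ z≢b ∷ z∉R) z≢x z≢y → z≢x ∷ z≢a ∷ z≢b ∷ z≢y ∷ z∉R }
  augment-path ((u , v) ∷ R) {x = x} {y} ((u≢v ∷ u∉R) ∷ v∉R ∷ R-unique) (uv ∷ R-edges) (there p)
               (x≢u ∷ x≢v ∷ x∉R) (y≢u ∷ y≢v ∷ y∉R) x≢y xa by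
    with augment-path R R-unique R-edges p x∉R y∉R x≢y xa by
  ... | R′ , R′-unique , R′-edges , R′-length , R′-avoids =
    ((u , v) ∷ R′) ,
    ((u≢v ∷ R′-avoids u u∉R (λ e → x≢u (sym e)) (λ e → y≢u (sym e)))
      ∷ R′-avoids v v∉R (λ e → x≢v (sym e)) (λ e → y≢v (sym e)) ∷ R′-unique) ,
    uv ∷ R′-edges , cong suc R′-length ,
    λ { z (z≢u ∷ z≢v ∷ z∉R) z≢x z≢y → z≢u ∷ z≢v ∷ R′-avoids z z∉R z≢x z≢y }

-- An edge a b of M gets the centre a if a has an
-- uncovered neighbour and b otherwise; an uncovered vertex joins the star of the edge
-- covering one of its neighbours.  Maximality of M (no free edge, no augmenting path
-- of length three) makes every vertex adjacent to its assigned centre.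
module FromMaximumMatching {n : ℕ} (G : Graph n) (neighbour : ∀ x → ∃[ w ] (adj G x w ≡ true))
  (M : Edges n) (M-matching : IsMatching G M)
  (M-maximum : ∀ M′ → IsMatching G M′ → length M′ ≤ length M) where
  open Augment G
  open import Data.List.Membership.DecPropositional (_≟_ {n}) using () renaming (_∈?_ to _∈ₗ?_)

  private
    M-edges : All IsEdge M
    M-edges = proj₁ M-matching
    M-unique : Unique (endpoints M)
    M-unique = proj₂ M-matching

  Covered : Fin n → Set
  Covered v = v ∈ₗ endpoints M

  covered? : ∀ v → Dec (Covered v)
  covered? v = v ∈ₗ? endpoints M

  no-free-edge : ∀ {x y} → ¬ Covered x → ¬ Covered y → adj G x y ≡ true → ⊥
  no-free-edge x∉ y∉ xy =
    n≮n _ (M-maximum _ (augment-free-edge M M-matching (¬Any⇒All¬ _ x∉) (¬Any⇒All¬ _ y∉) xy))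

  no-augmenting-path : ∀ {a b x y} → (a , b) ∈ₗ M → ¬ Covered x → ¬ Covered y → x ≢ y →
    adj G x a ≡ true → adj G b y ≡ true → ⊥
  no-augmenting-path ab∈M x∉ y∉ x≢y xa by
    with augment-path M M-unique M-edges ab∈M (¬Any⇒All¬ _ x∉) (¬Any⇒All¬ _ y∉) x≢y xa by
  ... | M′ , M′-unique , M′-edges , M′-length , _ =
    n≮n _ (subst (_≤ length M) M′-length (M-maximum M′ (M′-edges , M′-unique)))

  HasFreeNeighbour : Fin n → Set
  HasFreeNeighbour a = ∃[ x ] (¬ Covered x × adj G x a ≡ true)

  hasFreeNeighbour? : ∀ a → Dec (HasFreeNeighbour a)
  hasFreeNeighbour? a = any? (λ x → ¬? (covered? x) ×-dec (adj G x a Bool.≟ true))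

  edgeCentre : Fin n × Fin n → Fin n
  edgeCentre (a , b) = if does (hasFreeNeighbour? a) then a else b

  edgeCentre-cases : ∀ a b →
    (edgeCentre (a , b) ≡ a × HasFreeNeighbour a) ⊎ (edgeCentre (a , b) ≡ b × ¬ HasFreeNeighbour a)
  edgeCentre-cases a b with hasFreeNeighbour? a
  ... | yes p = inj₁ (refl , p)
  ... | no ¬p = inj₂ (refl , ¬p)

  edgeCentre-end : ∀ a b → edgeCentre (a , b) ≡ a ⊎ edgeCentre (a , b) ≡ b
  edgeCentre-end a b = ⊎-map proj₁ proj₁ (edgeCentre-cases a b)

  centreAt : Fin n → Fin n
  centreAt w = edgeCentre (edgeAt M w)

  record LocatedEdge (w : Fin n) : Set where
    field
      a b       : Fin n
      located   : edgeAt M w ≡ (a , b)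
      ab∈M      : (a , b) ∈ₗ M
      w-end     : w ≡ a ⊎ w ≡ b
      located-a : edgeAt M a ≡ (a , b)
      located-b : edgeAt M b ≡ (a , b)
      a≢b       : a ≢ b
      a-covered : Covered a
      b-covered : Covered b
      ab-edge   : adj G a b ≡ true

    centreAt≡ : centreAt w ≡ edgeCentre (a , b)
    centreAt≡ = cong edgeCentre located

  locate : ∀ w → Covered w → LocatedEdge w
  locate w w∈ = record
    { a = proj₁ (edgeAt M w) ; b = proj₂ (edgeAt M w) ; located = refl ; ab∈M = e∈M
    ; w-end = proj₂ (edgeAt-∈ M w∈)
    ; located-a = proj₁ (edgeAt-ends M M-unique e∈M) ; located-b = proj₂ (edgeAt-ends M M-unique e∈M)
    ; a≢b = ends-distinct M M-unique e∈M ; a-covered = proj₁ (ends∈endpoints M e∈M)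
    ; b-covered = proj₂ (ends∈endpoints M e∈M) ; ab-edge = All.lookup M-edges e∈M }
    where
    e∈M : edgeAt M w ∈ₗ M
    e∈M = proj₁ (edgeAt-∈ M w∈)

  -- The covered vertex whose M-edge determines the star of v: v itself, or the
  -- chosen neighbour of an uncovered v (covered, as M has no free edge).
  anchor : Fin n → Fin n
  anchor v with covered? v
  ... | yes _ = v
  ... | no _ = proj₁ (neighbour v)

  neighbour-covered : ∀ v → ¬ Covered v → Covered (proj₁ (neighbour v))
  neighbour-covered v v∉ with covered? (proj₁ (neighbour v))
  ... | yes w∈ = w∈
  ... | no w∉ = ⊥-elim (no-free-edge v∉ w∉ (proj₂ (neighbour v)))

  anchor-covered : ∀ v → Covered (anchor v)
  anchor-covered v with covered? v
  ... | yes v∈ = v∈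
  ... | no v∉ = neighbour-covered v v∉

  anchor-of-covered : ∀ v → Covered v → anchor v ≡ v
  anchor-of-covered v v∈ with covered? v
  ... | yes _ = refl
  ... | no v∉ = ⊥-elim (v∉ v∈)

  anchor-of-uncovered : ∀ v → ¬ Covered v → anchor v ≡ proj₁ (neighbour v)
  anchor-of-uncovered v v∉ with covered? v
  ... | yes v∈ = ⊥-elim (v∉ v∈)
  ... | no _ = refl

  centre : Fin n → Fin n
  centre v = centreAt (anchor v)

  centre-of-covered : ∀ v → Covered v → centre v ≡ centreAt v
  centre-of-covered v v∈ = cong centreAt (anchor-of-covered v v∈)

  module _ {w : Fin n} (L : LocatedEdge w) where
    open LocatedEdge L

    centreAt-stable : Covered (centreAt w) × centreAt (centreAt w) ≡ centreAt w
    centreAt-stable with edgeCentre-end a b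
    ... | inj₁ c≡a = subst Covered (sym (trans centreAt≡ c≡a)) a-covered
                   , trans (cong centreAt (trans centreAt≡ c≡a)) (trans (cong edgeCentre located-a) (sym centreAt≡))
    ... | inj₂ c≡b = subst Covered (sym (trans centreAt≡ c≡b)) b-covered
                   , trans (cong centreAt (trans centreAt≡ c≡b)) (trans (cong edgeCentre located-b) (sym centreAt≡))

    -- w is the centre or the other end of its M-edge.
    centreAt-adj : centreAt w ≢ w → adj G w (centreAt w) ≡ true
    centreAt-adj c≢w with edgeCentre-end a b | w-end
    ... | inj₁ c≡a | inj₁ w≡a = ⊥-elim (c≢w (trans centreAt≡ (trans c≡a (sym w≡a))))
    ... | inj₁ c≡a | inj₂ w≡b = adj-resp G (sym w≡b) (sym (trans centreAt≡ c≡a)) (adj-sym G _ _ ab-edge)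
    ... | inj₂ c≡b | inj₁ w≡a = adj-resp G (sym w≡a) (sym (trans centreAt≡ c≡b)) ab-edge
    ... | inj₂ c≡b | inj₂ w≡b = ⊥-elim (c≢w (trans centreAt≡ (trans c≡b (sym w≡b))))

    -- An uncovered neighbour v of w is adjacent to the centre: otherwise v would be
    -- a free neighbour of the uncentred end a, or the end of an augmenting path x a b v.
    joins-neighbour-star : ∀ v → ¬ Covered v → adj G v w ≡ true → adj G v (centreAt w) ≡ true
    joins-neighbour-star v v∉ vw with edgeCentre-cases a b | w-end
    ... | inj₁ (c≡a , _) | inj₁ w≡a = adj-resp G refl (trans w≡a (sym (trans centreAt≡ c≡a))) vw
    ... | inj₁ (c≡a , x , x∉ , xa) | inj₂ w≡b with v ≟ x
    ...   | yes v≡x = adj-resp G (sym v≡x) (sym (trans centreAt≡ c≡a)) xa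
    ...   | no v≢x = ⊥-elim (no-augmenting-path ab∈M x∉ v∉ (λ e → v≢x (sym e)) xa
                       (adj-sym G _ _ (adj-resp G refl w≡b vw)))
    joins-neighbour-star v v∉ vw | inj₂ (_ , ¬free) | inj₁ w≡a =
      ⊥-elim (¬free (v , v∉ , adj-resp G refl w≡a vw))
    joins-neighbour-star v v∉ vw | inj₂ (c≡b , _) | inj₂ w≡b =
      adj-resp G refl (trans w≡b (sym (trans centreAt≡ c≡b))) vw

    other-end-leaf : ∃[ u ] (Covered u × centreAt u ≡ centreAt w × u ≢ centreAt w)
    other-end-leaf with edgeCentre-end a b
    ... | inj₁ c≡a = b , b-covered , trans (cong edgeCentre located-b) (sym centreAt≡)
                   , λ b≡c → a≢b (sym (trans b≡c (trans centreAt≡ c≡a)))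
    ... | inj₂ c≡b = a , a-covered , trans (cong edgeCentre located-a) (sym centreAt≡)
                   , λ a≡c → a≢b (trans a≡c (trans centreAt≡ c≡b))

  centre-idem : ∀ v → centre (centre v) ≡ centre v
  centre-idem v = trans (centre-of-covered _ (proj₁ stable)) (proj₂ stable)
    where
    stable : Covered (centre v) × centreAt (centre v) ≡ centre v
    stable = centreAt-stable (locate _ (anchor-covered v))

  -- A covered vertex reaches its centre along its M-edge, an uncovered one through its
  -- chosen neighbour.  The split is on a fresh copy of the decision made in anchor,
  -- which is then related to anchor by anchor-of-covered and anchor-of-uncovered.
  centre-adj : ∀ v → centre v ≢ v → adj G v (centre v) ≡ true
  centre-adj v c≢v = by-cases (covered? v)
    where
    by-cases : Dec (Covered v) → adj G v (centre v) ≡ true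
    by-cases (yes v∈) = adj-resp G refl (sym (centre-of-covered v v∈))
      (centreAt-adj (locate v v∈) (λ e → c≢v (trans (centre-of-covered v v∈) e)))
    by-cases (no v∉) = adj-resp G refl (sym (cong centreAt (anchor-of-uncovered v v∉)))
      (joins-neighbour-star (locate _ (neighbour-covered v v∉)) v v∉ (proj₂ (neighbour v)))

  -- The other end of the M-edge at the anchor is a leaf.
  has-leaf : ∀ v → ∃[ u ] (centre u ≡ centre v × u ≢ centre v)
  has-leaf v with other-end-leaf (locate (anchor v) (anchor-covered v))
  ... | u , u∈ , same , u≢c = u , trans (centre-of-covered u u∈) same , u≢c

  centreMap : CentreMap G
  centreMap = record { centre = centre ; centre-idem = centre-idem ; centre-adj = centre-adj ; has-leaf = has-leaf }

  open StarFactorOf centreMap using (centres; fixed⇒∈centres)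

  edgeCentre-fixed : ∀ {e} → e ∈ₗ M → centre (edgeCentre e) ≡ edgeCentre e
  edgeCentre-fixed {a , b} e∈M =
    subst (λ c → centre c ≡ c) (cong edgeCentre (proj₁ (edgeAt-ends M M-unique e∈M)))
      (trans (centre-of-covered _ (proj₁ stable)) (proj₂ stable))
    where
    stable : Covered (centreAt a) × centreAt (centreAt a) ≡ centreAt a
    stable = centreAt-stable (locate a (proj₁ (ends∈endpoints M e∈M)))

  edgeCentres-unique : ∀ (N : Edges n) → Unique (endpoints N) → Unique (map edgeCentre N)
  edgeCentres-unique [] _ = []
  edgeCentres-unique ((a , b) ∷ N) ((_ ∷ a∉N) ∷ b∉N ∷ N-unique) =
    fresh (edgeCentre-end a b) ∷ edgeCentres-unique N N-unique
    where
    avoid : ∀ {c} (K : Edges n) → All (c ≢_) (endpoints K) → All (c ≢_) (map edgeCentre K)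
    avoid [] _ = []
    avoid ((u , v) ∷ K) (c≢u ∷ c≢v ∷ c∉K) with edgeCentre-end u v
    ... | inj₁ e = (λ q → c≢u (trans q e)) ∷ avoid K c∉K
    ... | inj₂ e = (λ q → c≢v (trans q e)) ∷ avoid K c∉K
    fresh : (edgeCentre (a , b) ≡ a ⊎ edgeCentre (a , b) ≡ b) → All (edgeCentre (a , b) ≢_) (map edgeCentre N)
    fresh (inj₁ e) = subst (λ c → All (c ≢_) (map edgeCentre N)) (sym e) (avoid N a∉N)
    fresh (inj₂ e) = subst (λ c → All (c ≢_) (map edgeCentre N)) (sym e) (avoid N b∉N)

  matching≤centres : length M ≤ ∣ centres ∣
  matching≤centres = subst (_≤ ∣ centres ∣) (length-map edgeCentre M)
    (unique⇒length≤∣∣ centres (map edgeCentre M) (edgeCentres-unique M M-unique)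
      (map⁺ (All.tabulate (λ e∈M → fixed⇒∈centres _ (edgeCentre-fixed e∈M)))))

-- Every v ∉ S picks a dominator in S (v is
-- then a dependent of it).  By minimality, a vertex s ∈ S without dependents has its
-- chosen neighbour outside S; that neighbour is borrowed by s and becomes a centre
-- with leaf s.  Every other v ∉ S is a leaf of its dominator, and a vertex of S all
-- of whose dependents are borrowed is a leaf of one of them.  So each centre is
-- either a vertex of S with a dependent or a vertex borrowed by a vertex of S.
module FromMinimumDominatingSet {n : ℕ} (G : Graph n) (neighbour : ∀ x → ∃[ w ] (adj G x w ≡ true))
  (S : Subset n) (S-dominating : IsDominating G S)
  (S-minimum : ∀ S′ → IsDominating G S′ → ∣ S ∣ ≤ ∣ S′ ∣) where

  private
    Dominated : Fin n → Set
    Dominated v = v ∈ S ⊎ ∃[ u ] (u ∈ S × adj G u v ≡ true)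

    dominatorOf : ∀ v → Dominated v → Fin n
    dominatorOf v (inj₁ _) = v
    dominatorOf v (inj₂ (u , _)) = u

    dominatorOf-outside : ∀ v → v ∉ S → (d : Dominated v) →
      dominatorOf v d ∈ S × adj G (dominatorOf v d) v ≡ true
    dominatorOf-outside v v∉S (inj₁ v∈S) = ⊥-elim (v∉S v∈S)
    dominatorOf-outside v v∉S (inj₂ (u , u∈S , uv)) = u∈S , uv

  dominator : Fin n → Fin n
  dominator v = dominatorOf v (S-dominating v)

  dominator-∈ : ∀ v → v ∉ S → dominator v ∈ S
  dominator-∈ v v∉S = proj₁ (dominatorOf-outside v v∉S (S-dominating v))

  dominator-adj : ∀ v → v ∉ S → adj G (dominator v) v ≡ true
  dominator-adj v v∉S = proj₂ (dominatorOf-outside v v∉S (S-dominating v))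

  ∈≢∉ : ∀ {x y} → x ∈ S → y ∉ S → x ≢ y
  ∈≢∉ x∈S y∉S refl = y∉S x∈S

  HasDependent : Fin n → Set
  HasDependent s = ∃[ v ] (v ∉ S × dominator v ≡ s)

  hasDependent? : ∀ s → Dec (HasDependent s)
  hasDependent? s = any? (λ v → ¬? (v ∈? S) ×-dec (dominator v ≟ s))

  partner : Fin n → Fin n
  partner s = proj₁ (neighbour s)

  partner-adj : ∀ s → adj G s (partner s) ≡ true
  partner-adj s = proj₂ (neighbour s)

  -- Minimality of S: otherwise S - s would still dominate G.
  partner-outside : ∀ s → s ∈ S → ¬ HasDependent s → partner s ∉ S
  partner-outside s s∈S no-dependent partner∈S =
    n≮n _ (≤-trans (x∈p⇒∣p-x∣<∣p∣ s∈S) (S-minimum (S - s) smaller))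
    where
    smaller : IsDominating G (S - s)
    smaller v with v ≟ s | v ∈? S
    ... | yes refl | _ = inj₂ (partner s , x∈p∧x≢y⇒x∈p-y partner∈S (λ e → adj⇒≢ G (partner-adj s) (sym e)) ,
                                adj-sym G _ _ (partner-adj s))
    ... | no v≢s | yes v∈S = inj₁ (x∈p∧x≢y⇒x∈p-y v∈S v≢s)
    ... | no v≢s | no v∉S =
      inj₂ (dominator v , x∈p∧x≢y⇒x∈p-y (dominator-∈ v v∉S) (λ e → no-dependent (v , v∉S , e)) , dominator-adj v v∉S)

  Borrowed : Fin n → Set
  Borrowed x = x ∉ S × ∃[ s ] (s ∈ S × ¬ HasDependent s × partner s ≡ x)

  borrowed? : ∀ x → Dec (Borrowed x)
  borrowed? x = ¬? (x ∈? S) ×-dec any? (λ s → (s ∈? S) ×-dec ¬? (hasDependent? s) ×-dec (partner s ≟ x))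

  HasFreeDependent : Fin n → Set
  HasFreeDependent c = ∃[ u ] (u ∉ S × dominator u ≡ c × ¬ Borrowed u)

  hasFreeDependent? : ∀ c → Dec (HasFreeDependent c)
  hasFreeDependent? c = any? (λ u → ¬? (u ∈? S) ×-dec (dominator u ≟ c) ×-dec ¬? (borrowed? u))

  centreBy : ∀ v → Dec (v ∈ S) → Dec (HasDependent v) → Dec (HasFreeDependent v) → Dec (Borrowed v) → Fin n
  centreBy v (yes _) (yes _) (yes _) _ = v
  centreBy v (yes _) (yes dependent) (no _) _ = proj₁ dependent
  centreBy v (yes _) (no _) _ _ = partner v
  centreBy v (no _) _ _ (yes _) = v
  centreBy v (no _) _ _ (no _) = dominator v

  centre : Fin n → Fin n
  centre v = centreBy v (v ∈? S) (hasDependent? v) (hasFreeDependent? v) (borrowed? v)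

  data Kind (v : Fin n) : Set where
    lonely   : v ∈ S → ¬ HasDependent v → centre v ≡ partner v → Kind v
    absorbed : v ∈ S → (d : HasDependent v) → ¬ HasFreeDependent v → centre v ≡ proj₁ d → Kind v
    hub      : v ∈ S → HasFreeDependent v → centre v ≡ v → Kind v
    borrowed : v ∉ S → Borrowed v → centre v ≡ v → Kind v
    follower : v ∉ S → ¬ Borrowed v → centre v ≡ dominator v → Kind v

  kind : ∀ v → Kind v
  kind v = classify (v ∈? S) (hasDependent? v) (hasFreeDependent? v) (borrowed? v) refl
    where
    classify : ∀ a b c d → centre v ≡ centreBy v a b c d → Kind v
    classify (yes v∈S) (yes _) (yes free) _ eq = hub v∈S free eq
    classify (yes v∈S) (yes dependent) (no ¬free) _ eq = absorbed v∈S dependent ¬free eq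
    classify (yes v∈S) (no ¬dependent) _ _ eq = lonely v∈S ¬dependent eq
    classify (no v∉S) _ _ (yes b) eq = borrowed v∉S b eq
    classify (no v∉S) _ _ (no ¬b) eq = follower v∉S ¬b eq

  free⇒dependent : ∀ {c} → HasFreeDependent c → HasDependent c
  free⇒dependent (u , u∉S , du , _) = u , u∉S , du

  centre-borrowed : ∀ x → Borrowed x → centre x ≡ x
  centre-borrowed x b with kind x
  ... | lonely x∈S _ _ = ⊥-elim (proj₁ b x∈S)
  ... | absorbed x∈S _ _ _ = ⊥-elim (proj₁ b x∈S)
  ... | hub x∈S _ _ = ⊥-elim (proj₁ b x∈S)
  ... | borrowed _ _ eq = eq
  ... | follower _ ¬b _ = ⊥-elim (¬b b)

  centre-hub : ∀ c → c ∈ S → HasFreeDependent c → centre c ≡ c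
  centre-hub c c∈S free with kind c
  ... | lonely _ ¬dependent _ = ⊥-elim (¬dependent (free⇒dependent free))
  ... | absorbed _ _ ¬free _ = ⊥-elim (¬free free)
  ... | hub _ _ eq = eq
  ... | borrowed c∉S _ _ = ⊥-elim (c∉S c∈S)
  ... | follower c∉S _ _ = ⊥-elim (c∉S c∈S)

  centre-lonely : ∀ s → s ∈ S → ¬ HasDependent s → centre s ≡ partner s
  centre-lonely s s∈S ¬dependent with kind s
  ... | lonely _ _ eq = eq
  ... | absorbed _ dependent _ _ = ⊥-elim (¬dependent dependent)
  ... | hub _ free _ = ⊥-elim (¬dependent (free⇒dependent free))
  ... | borrowed s∉S _ _ = ⊥-elim (s∉S s∈S)
  ... | follower s∉S _ _ = ⊥-elim (s∉S s∈S)

  centre-follower : ∀ v → v ∉ S → ¬ Borrowed v → centre v ≡ dominator v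
  centre-follower v v∉S ¬b with kind v
  ... | lonely v∈S _ _ = ⊥-elim (v∉S v∈S)
  ... | absorbed v∈S _ _ _ = ⊥-elim (v∉S v∈S)
  ... | hub v∈S _ _ = ⊥-elim (v∉S v∈S)
  ... | borrowed _ b _ = ⊥-elim (¬b b)
  ... | follower _ _ eq = eq

  dependent-borrowed : ∀ v → (d : HasDependent v) → ¬ HasFreeDependent v → Borrowed (proj₁ d)
  dependent-borrowed v (u , u∉S , du) ¬free with borrowed? u
  ... | yes b = b
  ... | no ¬b = ⊥-elim (¬free (u , u∉S , du , ¬b))

  -- Every assigned centre is a hub or a borrowed vertex.
  centre-idem : ∀ v → centre (centre v) ≡ centre v
  centre-idem v with kind v
  ... | lonely v∈S ¬d eq = trans (cong centre eq)
        (trans (centre-borrowed (partner v) (partner-outside v v∈S ¬d , v , v∈S , ¬d , refl)) (sym eq))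
  ... | absorbed _ d ¬free eq = trans (cong centre eq)
        (trans (centre-borrowed _ (dependent-borrowed v d ¬free)) (sym eq))
  ... | hub _ _ eq = cong centre eq
  ... | borrowed _ _ eq = cong centre eq
  ... | follower v∉S ¬b eq = trans (cong centre eq)
        (trans (centre-hub (dominator v) (dominator-∈ v v∉S) (v , v∉S , refl , ¬b)) (sym eq))

  -- Leaves are attached along a dominator or partner edge.
  centre-adj : ∀ v → centre v ≢ v → adj G v (centre v) ≡ true
  centre-adj v c≢v with kind v
  ... | lonely _ _ eq = adj-resp G refl (sym eq) (partner-adj v)
  ... | absorbed _ (u , u∉S , du) _ eq = adj-resp G du (sym eq) (dominator-adj u u∉S)
  ... | hub _ _ eq = ⊥-elim (c≢v eq)
  ... | borrowed _ _ eq = ⊥-elim (c≢v eq)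
  ... | follower v∉S _ eq = adj-resp G refl (sym eq) (adj-sym G _ _ (dominator-adj v v∉S))

  -- A hub keeps a free dependent and a borrowed vertex the vertex borrowing it.
  has-leaf : ∀ v → ∃[ u ] (centre u ≡ centre v × u ≢ centre v)
  has-leaf v with kind v
  ... | lonely _ _ eq = v , refl , λ v≡c → adj⇒≢ G (partner-adj v) (trans v≡c eq)
  ... | absorbed v∈S (u , u∉S , _) _ eq = v , refl , λ v≡c → ∈≢∉ v∈S u∉S (trans v≡c eq)
  ... | hub v∈S (u , u∉S , du , ¬b) eq = u , trans (centre-follower u u∉S ¬b) (trans du (sym eq))
                                      , λ u≡c → ∈≢∉ v∈S u∉S (sym (trans u≡c eq))
  ... | borrowed v∉S (_ , s , s∈S , ¬d , ps) eq = s , trans (centre-lonely s s∈S ¬d) (trans ps (sym eq))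
                                              , λ s≡c → ∈≢∉ s∈S v∉S (trans s≡c eq)
  ... | follower v∉S _ eq = v , refl , λ v≡c → ∈≢∉ (dominator-∈ v v∉S) v∉S (sym (trans v≡c eq))

  centreMap : CentreMap G
  centreMap = record { centre = centre ; centre-idem = centre-idem ; centre-adj = centre-adj ; has-leaf = has-leaf }

  open StarFactorOf centreMap using (centres; ∈centres⇒fixed)

  CentreWitness : Fin n → Set
  CentreWitness x = (x ∈ S × HasDependent x) ⊎ Borrowed x

  centre-witness : ∀ x → centre x ≡ x → CentreWitness x
  centre-witness x cx with kind x
  ... | lonely _ _ eq = ⊥-elim (adj⇒≢ G (partner-adj x) (trans (sym cx) eq))
  ... | absorbed x∈S (u , u∉S , _) _ eq = ⊥-elim (∈≢∉ x∈S u∉S (trans (sym cx) eq))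
  ... | hub x∈S free _ = inj₁ (x∈S , free⇒dependent free)
  ... | borrowed _ b _ = inj₂ b
  ... | follower x∉S _ eq = ⊥-elim (∈≢∉ (dominator-∈ x x∉S) x∉S (trans (sym eq) cx))

  -- The vertex of S responsible for a centre: itself, or the vertex borrowing it.
  owner : ∀ x → CentreWitness x → Fin n
  owner x (inj₁ _) = x
  owner x (inj₂ (_ , s , _)) = s

  owner-∈ : ∀ x w → owner x w ∈ S
  owner-∈ x (inj₁ (x∈S , _)) = x∈S
  owner-∈ x (inj₂ (_ , _ , s∈S , _)) = s∈S

  owner-injective : ∀ x y w w′ → owner x w ≡ owner y w′ → x ≡ y
  owner-injective x y (inj₁ _) (inj₁ _) e = e
  owner-injective x y (inj₁ (_ , dx)) (inj₂ (_ , _ , _ , ¬d , _)) e = ⊥-elim (¬d (subst HasDependent e dx))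
  owner-injective x y (inj₂ (_ , _ , _ , ¬d , _)) (inj₁ (_ , dy)) e = ⊥-elim (¬d (subst HasDependent (sym e) dy))
  owner-injective x y (inj₂ (_ , _ , _ , _ , px)) (inj₂ (_ , _ , _ , _ , py)) e =
    trans (sym px) (trans (cong partner e) py)

  centres≤dominating : ∣ centres ∣ ≤ ∣ S ∣
  centres≤dominating = injection⇒∣∣≤ centres S
    (λ x p → owner x (witness x p)) (λ x p → owner-∈ x (witness x p))
    (λ x y p q → owner-injective x y (witness x p) (witness y q))
    where
    witness : ∀ x → x ∈ centres → CentreWitness x
    witness x p = centre-witness x (∈centres⇒fixed x p)

StarFactorWith : ∀ {n} → Graph n → (ℕ → Set) → Set
StarFactorWith {n} G P = Σ (Fin n → Fin n → Bool) λ F → IsStarFactor G F × ∃[ k ] (HasComponents F k × P k)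

star-factor-≥ν : ∀ {n} (G : Graph n) → (∀ x → ∃[ w ] (adj G x w ≡ true)) →
  ∀ ν → IsMatchingNumber G ν → StarFactorWith G (ν ≤_)
star-factor-≥ν G neighbour ν ((M , M-matching , M-length) , ν-max) =
  starGraph , starGraph-factor , ∣ centres ∣ , starGraph-components ,
  subst (_≤ ∣ centres ∣) M-length matching≤centres
  where
  M-maximum : ∀ M′ → IsMatching G M′ → length M′ ≤ length M
  M-maximum M′ M′-matching = subst (length M′ ≤_) (sym M-length) (ν-max M′ M′-matching)
  open FromMaximumMatching G neighbour M M-matching M-maximum using (centreMap; matching≤centres)
  open StarFactorOf centreMap

star-factor-≤γ : ∀ {n} (G : Graph n) → (∀ x → ∃[ w ] (adj G x w ≡ true)) →
  ∀ γ → IsDominationNumber G γ → StarFactorWith G (_≤ γ)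
star-factor-≤γ G neighbour γ ((S , S-dominating , S-size) , γ-min) =
  starGraph , starGraph-factor , ∣ centres ∣ , starGraph-components ,
  subst (∣ centres ∣ ≤_) S-size centres≤dominating
  where
  S-minimum : ∀ S′ → IsDominating G S′ → ∣ S ∣ ≤ ∣ S′ ∣
  S-minimum S′ S′-dominating = subst (_≤ ∣ S′ ∣) (sym S-size) (γ-min S′ S′-dominating)
  open FromMinimumDominatingSet G neighbour S S-dominating S-minimum using (centreMap; centres≤dominating)
  open StarFactorOf centreMap

theorem3 : ∀ (n : ℕ) → 2 ≤ n → (G : Graph n) → Connected G →
    ∀ (ν γ : ℕ) → IsMatchingNumber G ν → IsDominationNumber G γ →
    (StarUniform G ⇔ ν ≡ γ)
theorem3 n 2≤n G connected ν γ ν-max γ-min = mk⇔ uniform⇒ν≡γ ν≡γ⇒uniform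
  where
  open StarFactorBounds G using (components≤ν; γ≤components; components≡ν)
  neighbour : ∀ x → ∃[ w ] (adj G x w ≡ true)
  neighbour = connected⇒neighbour 2≤n G connected

  uniform⇒ν≡γ : StarUniform G → ν ≡ γ
  uniform⇒ν≡γ uniform = compare (star-factor-≥ν G neighbour ν ν-max) (star-factor-≤γ G neighbour γ γ-min)
    where
    compare : StarFactorWith G (ν ≤_) → StarFactorWith G (_≤ γ) → ν ≡ γ
    compare (F₁ , F₁-factor , k₁ , F₁-comps , ν≤k₁) (F₂ , F₂-factor , k₂ , F₂-comps , k₂≤γ) =
      ≤-antisym (≤-trans ν≤k₁ (subst (_≤ γ) (sym k₁≡k₂) k₂≤γ))
                (≤-trans (γ≤components F₁ F₁-factor k₁ F₁-comps γ γ-min)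
                         (components≤ν F₁ F₁-factor k₁ F₁-comps ν ν-max))
      where
      k₁≡k₂ : k₁ ≡ k₂
      k₁≡k₂ = uniform F₁ F₂ k₁ k₂ F₁-factor F₂-factor F₁-comps F₂-comps

  ν≡γ⇒uniform : ν ≡ γ → StarUniform G
  ν≡γ⇒uniform ν≡γ F₁ F₂ k₁ k₂ F₁-factor F₂-factor F₁-comps F₂-comps =
    trans (components≡ν F₁ F₁-factor k₁ F₁-comps ν γ ν-max γ-min ν≡γ)
          (sym (components≡ν F₂ F₂-factor k₂ F₂-comps ν γ ν-max γ-min ν≡γ))
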